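{- Let $n \geq 1$ be an integer and $m = 2^n$. Then the edge set of the hypercube $Q_m$ contains $m$ pairwise edge-disjoint perfect matchings $M_1, \dots, M_m$ such that for every $i \in \{1,\dots,m\}$, the union $M_i \cup M_{i+1}$ (indices taken modulo $m$) is the edge set of a Hamiltonian cycle of $Q_m$.
   Context: The $m$-dimensional hypercube $Q_m$ has vertex set $\{0,1\}^m$, two vertices being adjacent iff they differ in exactly one coordinate. A perfect matching is a set of edges such that every vertex is incident to exactly one of them. -}

module Defs where

open import Data.Nat using (ℕ; zero; suc; _^_)
open import Data.Nat.DivMod using (_mod_)
open import Data.Bool using (Bool)
open import Data.Fin using (Fin; toℕ)
open import Data.Vec using (Vec; lookup)
open import Data.Product using (Σ; ∃; _×_)
open import Data.Sum using (_⊎_)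
open import Function.Definitions using (Bijective)
open import Relation.Binary.PropositionalEquality using (_≡_; _≢_)
open import Relation.Nullary using (¬_)

Vertex : ℕ → Set
Vertex m = Vec Bool m

Adjacent : (m : ℕ) → Vertex m → Vertex m → Set
Adjacent m u v =
  Σ (Fin m) λ i → (lookup u i ≢ lookup v i) × (∀ j → j ≢ i → lookup u j ≡ lookup v j)

-- A set of (undirected) edges, represented as a symmetric relation on vertices.
EdgeSet : ℕ → Set₁
EdgeSet m = Vertex m → Vertex m → Set

IsEdgeSetOf : (m : ℕ) → EdgeSet m → Set
IsEdgeSetOf m E = (∀ u v → E u v → Adjacent m u v) × (∀ u v → E u v → E v u)

IsPerfectMatching : (m : ℕ) → EdgeSet m → Set
IsPerfectMatching m M =
  IsEdgeSetOf m M ×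
  (∀ u → Σ (Vertex m) λ v → M u v × (∀ w → M u w → w ≡ v))

next : {N : ℕ} → Fin N → Fin N
next {zero} ()
next {suc N} i = suc (toℕ i) mod suc N

IsHamiltonianCycle : (m : ℕ) → (Fin (2 ^ m) → Vertex m) → Set
IsHamiltonianCycle m c =
  Bijective _≡_ _≡_ c × (∀ k → Adjacent m (c k) (c (next k)))

CycleEdges : (m : ℕ) → (Fin (2 ^ m) → Vertex m) → EdgeSet m
CycleEdges m c u v =
  ∃ λ k → (c k ≡ u × c (next k) ≡ v) ⊎ (c k ≡ v × c (next k) ≡ u)

_∪_ : {m : ℕ} → EdgeSet m → EdgeSet m → EdgeSet m
(E ∪ F) u v = E u v ⊎ F u v

IsHamiltonianCycleEdgeSet : (m : ℕ) → EdgeSet m → Set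
IsHamiltonianCycleEdgeSet m E =
  Σ (Fin (2 ^ m) → Vertex m) λ c →
    IsHamiltonianCycle m c ×
    (∀ u v → (E u v → CycleEdges m c u v) × (CycleEdges m c u v → E u v))

module Submission where

-- A perfect matching is handled as the involution f exchanging the ends of
-- its edges (IsMatching), and a Hamiltonian cycle made of two matchings f, g
-- as the walk from the origin alternating f and g, which must be a Tour:
-- it returns after 2^m steps and visits every vertex exactly once on the way.
-- We build by induction on n a CyclicFamily of Q_{2^n}: matchings p k, k ∈ ℕ,
-- periodic in k, with p k and p (k + j) disjoint for 0 < j < m, and with
-- p k, p (k+1) forming a tour.  The base case is the single edge Q_1.  The
-- Doubling step views Q_{2m} as Q_m × Q_m: matching 2h moves the first
-- coordinate by p h or p (h+1), matching 2h+1 the second, the choice being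
-- governed by a parity of the other coordinate.  Two consecutive new
-- matchings then wind around the torus C × C' of two old Hamiltonian cycles,
-- and the Torus module proves, via a closed form for the walk, that this is a
-- tour of all pairs.

open import Defs
open import Data.Nat using (ℕ; zero; suc; _+_; _*_; _∸_; _≤_; _<_; z≤n; s≤s; _^_; ⌊_/2⌋)
open import Data.Nat.Properties
open import Data.Nat.DivMod using (_/_; _%_; m<n⇒m%n≡m; n%n≡0; m≡m%n+[m/n]*n; m%n<n)
open import Data.Bool using (Bool; true; false; not; _xor_; _∧_; if_then_else_)
open import Data.Bool.Properties using (not-involutive; not-¬; ¬-not; if-not; not-distribˡ-xor; not-distribʳ-xor; xor-identityʳ)
open import Data.Vec using ([]; _∷_; _++_; lookup; replicate; take; drop)
open import Data.Vec.Properties using (take++drop≡id; ++-injective)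
open import Data.Fin using (Fin; toℕ; fromℕ<) renaming (zero to fz; suc to fs)
open import Data.Fin.Properties using (toℕ-injective; toℕ<n; toℕ-fromℕ<)
open import Data.Product using (Σ; ∃; _×_; _,_; proj₁; proj₂)
open import Data.Sum using (_⊎_; inj₁; inj₂)
open import Data.Empty using (⊥-elim)
open import Function using (_∘_)
open import Relation.Binary.PropositionalEquality
open import Relation.Nullary using (¬_; yes; no)
open import Relation.Binary.Definitions using (tri<; tri≈; tri>)

open ≡-Reasoning

isEven : ℕ → Bool
isEven zero    = true
isEven (suc n) = not (isEven n)

-- double k = 2k, by recursion so that it can be matched on.
double : ℕ → ℕ
double zero    = zero
double (suc k) = suc (suc (double k))

double≡+ : ∀ k → double k ≡ k + k
double≡+ zero    = refl
double≡+ (suc k) = cong suc (trans (cong suc (double≡+ k)) (sym (+-suc k k)))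

isEven-double+ : ∀ k x → isEven (double k + x) ≡ isEven x
isEven-double+ zero    x = refl
isEven-double+ (suc k) x = trans (not-involutive _) (isEven-double+ k x)

isEven-double : ∀ k → isEven (double k) ≡ true
isEven-double k = trans (cong isEven (sym (+-identityʳ (double k)))) (isEven-double+ k 0)

isEven-+double : ∀ x k → isEven (x + double k) ≡ isEven x
isEven-+double x k = trans (cong isEven (+-comm x (double k))) (isEven-double+ k x)

isEven-double∸ : ∀ k s → s ≤ double k → isEven (double k ∸ s) ≡ isEven s
isEven-double∸ k       zero          _               = isEven-double k
isEven-double∸ (suc k) (suc zero)    _               = cong not (isEven-double k)
isEven-double∸ (suc k) (suc (suc s)) (s≤s (s≤s s≤)) =
  trans (isEven-double∸ k s s≤) (sym (not-involutive _))

bin : ℕ → Bool → ℕ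
bin x false = double x
bin x true  = suc (double x)

divMod2 : ∀ s → Σ ℕ λ x → Σ Bool λ r → s ≡ bin x r
divMod2 zero = 0 , false , refl
divMod2 (suc s) with divMod2 s
... | x , false , e = x , true , cong suc e
... | x , true  , e = suc x , false , cong suc e

double-injective : ∀ a b → double a ≡ double b → a ≡ b
double-injective zero    zero    e = refl
double-injective (suc a) (suc b) e = cong suc (double-injective a b (suc-injective (suc-injective e)))

odd≢even : ∀ a b → suc (double a) ≢ double b
odd≢even zero    (suc zero) ()
odd≢even (suc a) (suc b)    e = odd≢even a b (suc-injective (suc-injective e))

double-+ : ∀ a b → double (a + b) ≡ double a + double b
double-+ zero    b = refl
double-+ (suc a) b = cong (λ n → suc (suc n)) (double-+ a b)

double-mono : ∀ {a b} → a ≤ b → double a ≤ double b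
double-mono z≤n       = z≤n
double-mono (s≤s a≤b) = s≤s (s≤s (double-mono a≤b))

double-cancel-≤ : ∀ a b → double a ≤ double b → a ≤ b
double-cancel-≤ zero    b       _               = z≤n
double-cancel-≤ (suc a) (suc b) (s≤s (s≤s a≤b)) = s≤s (double-cancel-≤ a b a≤b)

double-cancel-< : ∀ a b → double a < double b → a < b
double-cancel-< zero    (suc b) _               = s≤s z≤n
double-cancel-< (suc a) (suc b) (s≤s (s≤s a<b)) = s≤s (double-cancel-< a b a<b)

bin-cancel-< : ∀ x r y → bin x r < double y → x < y
bin-cancel-< x false y lt = double-cancel-< x y lt
bin-cancel-< x true  y lt = double-cancel-< x y (<-trans (n<1+n (double x)) lt)

bin-mono-< : ∀ x y r → x < y → bin x r < double y
bin-mono-< x y false lt = ≤-trans (n≤1+n (suc (double x))) (double-mono lt)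
bin-mono-< x y true  lt = double-mono lt

⌊double+/2⌋ : ∀ a k → ⌊ double a + k /2⌋ ≡ a + ⌊ k /2⌋
⌊double+/2⌋ zero    k = refl
⌊double+/2⌋ (suc a) k = cong suc (⌊double+/2⌋ a k)

⌊bin/2⌋ : ∀ a r → ⌊ bin a r /2⌋ ≡ a
⌊bin/2⌋ zero    false = refl
⌊bin/2⌋ zero    true  = refl
⌊bin/2⌋ (suc a) false = cong suc (⌊bin/2⌋ a false)
⌊bin/2⌋ (suc a) true  = cong suc (⌊bin/2⌋ a true)

isEven-bin : ∀ a r → isEven (bin a r) ≡ not r
isEven-bin a false = isEven-double a
isEven-bin a true  = cong not (isEven-double a)

alt : {A : Set} → (A → A) → (A → A) → A → ℕ → A
alt f g u zero    = u
alt f g u (suc t) = alt g f (f u) t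

module _ {A : Set} where

  alt-suc : (f g : A → A) (u : A) (t : ℕ) →
            alt f g u (suc t) ≡ (if isEven t then f else g) (alt f g u t)
  alt-suc f g u zero    = refl
  alt-suc f g u (suc t) = trans (alt-suc g f (f u) t) (cong-app (sym (if-not (isEven t))) _)

  alt-double+ : (f g : A → A) (u : A) (k t : ℕ) →
                alt f g u (double k + t) ≡ alt f g (alt f g u (double k)) t
  alt-double+ f g u zero    t = refl
  alt-double+ f g u (suc k) t = alt-double+ f g (g (f u)) k t

  alt-cong : (f g f' g' : A → A) → (∀ x → f x ≡ f' x) → (∀ x → g x ≡ g' x) →
             ∀ u t → alt f g u t ≡ alt f' g' u t
  alt-cong f g f' g' f≗ g≗ u zero    = refl
  alt-cong f g f' g' f≗ g≗ u (suc t) =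
    trans (alt-cong g f g' f' g≗ f≗ (f u) t) (cong (λ w → alt g' f' w t) (f≗ u))

alt-map : {A B : Set} (φ : A → B) (f g : A → A) (f' g' : B → B) →
          (∀ a → f' (φ a) ≡ φ (f a)) → (∀ a → g' (φ a) ≡ φ (g a)) →
          ∀ u t → alt f' g' (φ u) t ≡ φ (alt f g u t)
alt-map φ f g f' g' f~ g~ u zero    = refl
alt-map φ f g f' g' f~ g~ u (suc t) =
  trans (cong (λ w → alt g' f' w t) (f~ u)) (alt-map φ g f g' f' g~ f~ (f u) t)

if-involutive : {A : Set} {f g : A → A} → (∀ x → f (f x) ≡ x) → (∀ x → g (g x) ≡ x) →
                ∀ b x → (if b then f else g) ((if b then f else g) x) ≡ x
if-involutive f-inv g-inv true  x = f-inv x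
if-involutive f-inv g-inv false x = g-inv x

InjectiveBelow : {A : Set} → (ℕ → A) → ℕ → Set
InjectiveBelow w N = ∀ t t' → t < N → t' < N → w t ≡ w t' → t ≡ t'

SurjectiveBelow : {A : Set} → (ℕ → A) → ℕ → Set
SurjectiveBelow w N = ∀ x → Σ ℕ λ t → t < N × w t ≡ x

Tour : {A : Set} → (ℕ → A) → ℕ → Set
Tour w N = w N ≡ w 0 × InjectiveBelow w N × SurjectiveBelow w N

tour-≗ : {A : Set} {w w' : ℕ → A} {N : ℕ} → (∀ t → w t ≡ w' t) → Tour w N → Tour w' N
tour-≗ {N = N} w≗ (closed , injective , surjective) =
  trans (sym (w≗ N)) (trans closed (w≗ 0)) ,
  (λ t t' t< t'< eq → injective t t' t< t'< (trans (w≗ t) (trans eq (sym (w≗ t'))))) ,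
  (λ x → let (t , t< , wt≡x) = surjective x in t , t< , trans (sym (w≗ t)) wt≡x)

tour-of-shift : {A : Set} (w : ℕ → A) (N : ℕ) → w (suc N) ≡ w 0 →
  InjectiveBelow (λ s → w (suc s)) (suc N) → SurjectiveBelow (λ s → w (suc s)) (suc N) →
  Tour w (suc N)
tour-of-shift w N closed injective surjective = closed , injective₀ , surjective₀
  where
  injective₀ : InjectiveBelow w (suc N)
  injective₀ zero    zero     _  _   _ = refl
  injective₀ zero    (suc t') _  t'< e with injective N t' ≤-refl (<-trans (n<1+n t') t'<) (trans closed e)
  ... | refl = ⊥-elim (<-irrefl refl t'<)
  injective₀ (suc t) zero     t< _   e with injective t N (<-trans (n<1+n t) t<) ≤-refl (trans e (sym closed))
  ... | refl = ⊥-elim (<-irrefl refl t<)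
  injective₀ (suc t) (suc t') t< t'< e =
    cong suc (injective t t' (<-trans (n<1+n t) t<) (<-trans (n<1+n t') t'<) e)
  surjective₀ : SurjectiveBelow w (suc N)
  surjective₀ x with surjective x
  ... | s , s< , e with suc s <? suc N
  ... | yes p = suc s , p , e
  ... | no ¬p = 0 , s≤s z≤n ,
          trans (sym closed) (trans (cong (λ k → w (suc k)) (≤-antisym (≤-pred (≮⇒≥ ¬p)) (≤-pred s<))) e)

tour-map : {A B : Set} (φ : A → B) (ψ : B → A) → (∀ a → ψ (φ a) ≡ a) → (∀ b → φ (ψ b) ≡ b) →
           {w : ℕ → A} {N : ℕ} → Tour w N → Tour (φ ∘ w) N
tour-map φ ψ ψφ φψ (closed , injective , surjective) =
  cong φ closed ,
  (λ t t' t< t'< eq → injective t t' t< t'< (trans (sym (ψφ _)) (trans (cong ψ eq) (ψφ _)))) ,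
  (λ b → let (t , t< , wt≡) = surjective (ψ b) in t , t< , trans (cong φ wt≡) (φψ b))

∸-suc : ∀ n t → t < n → n ∸ t ≡ suc (n ∸ suc t)
∸-suc (suc n) zero    _         = refl
∸-suc (suc n) (suc t) (s≤s t<n) = ∸-suc n t t<n

module Reverse {A : Set} (f g : A → A) (f-inv : ∀ x → f (f x) ≡ x) (g-inv : ∀ x → g (g x) ≡ x)
  (u : A) (K : ℕ) (tour : Tour (alt f g u) (double (suc K))) where

  N : ℕ
  N = double (suc K)

  closed : alt f g u N ≡ u
  closed = proj₁ tour

  backwards : ∀ t → t ≤ N → alt g f u t ≡ alt f g u (N ∸ t)
  backwards zero    _  = sym closed
  backwards (suc t) t< = begin
    alt g f u (suc t)                           ≡⟨ alt-suc g f u t ⟩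
    step (alt g f u t)                          ≡⟨ cong step (backwards t (<⇒≤ t<)) ⟩
    step (alt f g u (N ∸ t))                    ≡⟨ cong (step ∘ alt f g u) (∸-suc N t t<) ⟩
    step (alt f g u (suc (N ∸ suc t)))          ≡⟨ cong step (alt-suc f g u (N ∸ suc t)) ⟩
    step ((if isEven (N ∸ suc t) then f else g) x) ≡⟨ cong (λ b → step ((if b then f else g) x)) N∸1+t-parity ⟩
    step ((if not (isEven t) then f else g) x)  ≡⟨ cong step (cong-app (if-not (isEven t)) x) ⟩
    step (step x)                               ≡⟨ if-involutive g-inv f-inv (isEven t) x ⟩
    x                                           ∎
    where
    step : A → A
    step = if isEven t then g else f
    x : A
    x = alt f g u (N ∸ suc t)
    N∸1+t-parity : isEven (N ∸ suc t) ≡ not (isEven t)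
    N∸1+t-parity = isEven-double∸ (suc K) (suc t) t<

  N∸1+a<N : ∀ a → suc a < N → N ∸ suc a < N
  N∸1+a<N a a< = ∸-monoʳ-< (s≤s z≤n) (<⇒≤ a<)

  reversed : Tour (alt g f u) N
  reversed = closed′ , injective′ , surjective′
    where
    injective : InjectiveBelow (alt f g u) N
    injective = proj₁ (proj₂ tour)
    surjective : SurjectiveBelow (alt f g u) N
    surjective = proj₂ (proj₂ tour)
    closed′ : alt g f u N ≡ u
    closed′ = trans (backwards N ≤-refl) (cong (alt f g u) (n∸n≡0 N))
    injective′ : InjectiveBelow (alt g f u) N
    injective′ zero    zero     _  _   _ = refl
    injective′ zero    (suc a') _  a'< e = ⊥-elim (<-irrefl
      (injective 0 (N ∸ suc a') (s≤s z≤n) (N∸1+a<N a' a'<) (trans e (backwards (suc a') (<⇒≤ a'<))))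
      (m<n⇒0<n∸m a'<))
    injective′ (suc a) zero     a< _   e = ⊥-elim (<-irrefl
      (injective 0 (N ∸ suc a) (s≤s z≤n) (N∸1+a<N a a<) (trans (sym e) (backwards (suc a) (<⇒≤ a<))))
      (m<n⇒0<n∸m a<))
    injective′ (suc a) (suc a') a< a'< e = ∸-cancelˡ-≡ (<⇒≤ a<) (<⇒≤ a'<)
      (injective _ _ (N∸1+a<N a a<) (N∸1+a<N a' a'<)
        (trans (sym (backwards (suc a) (<⇒≤ a<))) (trans e (backwards (suc a') (<⇒≤ a'<)))))
    surjective′ : SurjectiveBelow (alt g f u) N
    surjective′ x with surjective x
    ... | zero  , lt , e = 0 , lt , e
    ... | suc s , lt , e = N ∸ suc s , N∸1+a<N s lt ,
          trans (backwards (N ∸ suc s) (m∸n≤m N (suc s))) (trans (cong (alt f g u) (m∸[m∸n]≡n (<⇒≤ lt))) e)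

origin : ∀ {m} → Vertex m
origin {m} = replicate m false

data Adj : ∀ {m} → Vertex m → Vertex m → Set where
  here  : ∀ {m} b (u : Vertex m) → Adj (b ∷ u) (not b ∷ u)
  there : ∀ {m} b {u v : Vertex m} → Adj u v → Adj (b ∷ u) (b ∷ v)

Adj⇒Adjacent : ∀ {m} {u v : Vertex m} → Adj u v → Adjacent m u v
Adj⇒Adjacent (here b u) = fz , not-¬ refl , same
  where
  same : ∀ j → j ≢ fz → lookup (b ∷ u) j ≡ lookup (not b ∷ u) j
  same fz     j≢ = ⊥-elim (j≢ refl)
  same (fs j) _  = refl
Adj⇒Adjacent (there b {u} {v} a) with Adj⇒Adjacent a
... | i , differ , same = fs i , differ , same′
  where
  same′ : ∀ j → j ≢ fs i → lookup (b ∷ u) j ≡ lookup (b ∷ v) j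
  same′ fz     _  = refl
  same′ (fs j) j≢ = same j (j≢ ∘ cong fs)

Adj-irreflexive : ∀ {m} {u v : Vertex m} → Adj u v → u ≢ v
Adj-irreflexive (here true u)  ()
Adj-irreflexive (here false u) ()
Adj-irreflexive (there b a) refl = Adj-irreflexive a refl

Adj-++ˡ : ∀ {m n} {x x' : Vertex m} (y : Vertex n) → Adj x x' → Adj (x ++ y) (x' ++ y)
Adj-++ˡ y (here b u)  = here b (u ++ y)
Adj-++ˡ y (there b a) = there b (Adj-++ˡ y a)

Adj-++ʳ : ∀ {m n} (x : Vertex m) {y y' : Vertex n} → Adj y y' → Adj (x ++ y) (x ++ y')
Adj-++ʳ []      a = a
Adj-++ʳ (b ∷ x) a = there b (Adj-++ʳ x a)

origin-++ : ∀ {m n} → origin {m} ++ origin {n} ≡ origin {m + n}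
origin-++ {zero}  = refl
origin-++ {suc m} = cong (false ∷_) (origin-++ {m})

Pair : ℕ → Set
Pair m = Vertex m × Vertex m

join : ∀ {m} → Pair m → Vertex (m + m)
join (x , y) = x ++ y

split : ∀ {m} → Vertex (m + m) → Pair m
split {m} v = take m v , drop m v

split-join : ∀ {m} (w : Pair m) → split (join w) ≡ w
split-join {m} (x , y) with ++-injective (take m (x ++ y)) x (take++drop≡id m (x ++ y))
... | take≡ , drop≡ = cong₂ _,_ take≡ drop≡

join-split : ∀ {m} (v : Vertex (m + m)) → join {m} (split v) ≡ v
join-split {m} v = take++drop≡id m v

parity : ∀ {m} → Vertex m → Bool
parity []      = false
parity (b ∷ u) = b xor parity u

parity-Adj : ∀ {m} {u v : Vertex m} → Adj u v → parity v ≡ not (parity u)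
parity-Adj (here b u)          = sym (not-distribˡ-xor b (parity u))
parity-Adj (there b {u} a) = trans (cong (b xor_) (parity-Adj a)) (sym (not-distribʳ-xor b (parity u)))

parity-origin : ∀ {m} → parity (origin {m}) ≡ false
parity-origin {zero}  = refl
parity-origin {suc m} = parity-origin {m}

isOrigin : ∀ {m} → Vertex m → Bool
isOrigin []      = true
isOrigin (b ∷ u) = not b ∧ isOrigin u

isOrigin-origin : ∀ {m} → isOrigin (origin {m}) ≡ true
isOrigin-origin {zero}  = refl
isOrigin-origin {suc m} = isOrigin-origin {m}

isOrigin-≢ : ∀ {m} (u : Vertex m) → u ≢ origin → isOrigin u ≡ false
isOrigin-≢ []           u≢ = ⊥-elim (u≢ refl)
isOrigin-≢ (true ∷ u)  u≢ = refl
isOrigin-≢ (false ∷ u) u≢ = isOrigin-≢ u (u≢ ∘ cong (false ∷_))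

record IsMatching {m} (f : Vertex m → Vertex m) : Set where
  field
    involutive : ∀ x → f (f x) ≡ x
    adjacent   : ∀ x → Adj x (f x)

if-matching : ∀ {m} {f g : Vertex m → Vertex m} → IsMatching f → IsMatching g →
              ∀ b → IsMatching (if b then f else g)
if-matching f-match g-match true  = f-match
if-matching f-match g-match false = g-match

split-<2L : ∀ L A → A < L + L → A < L ⊎ Σ ℕ (λ A₀ → A₀ < L × A ≡ L + A₀)
split-<2L L A A< with A <? L
... | yes p = inj₁ p
... | no ¬p = inj₂ (A ∸ L , +-cancelˡ-< L _ _ (subst (_< L + L) (sym L+[A∸L]≡A) A<) , sym L+[A∸L]≡A)
  where
  L+[A∸L]≡A : L + (A ∸ L) ≡ A
  L+[A∸L]≡A = m+[n∸m]≡n (≮⇒≥ ¬p)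

module AltCycle {m : ℕ} {f g : Vertex m → Vertex m} (f-match : IsMatching f) (g-match : IsMatching g)
  (Q : ℕ) (tour : Tour (alt f g origin) (double (suc Q))) where

  L : ℕ
  L = double (suc Q)

  c : ℕ → Vertex m
  c = alt f g origin

  step : ℕ → Vertex m → Vertex m
  step a = if isEven a then f else g

  c-suc : ∀ a → c (suc a) ≡ step a (c a)
  c-suc a = alt-suc f g origin a

  c-pred : ∀ a → step a (c (suc a)) ≡ c a
  c-pred a = trans (cong (step a) (c-suc a)) (IsMatching.involutive (if-matching f-match g-match (isEven a)) (c a))

  c-L : c L ≡ origin
  c-L = proj₁ tour

  parity-c : ∀ a → parity (c a) ≡ not (isEven a)
  parity-c zero    = parity-origin {m}
  parity-c (suc a) = begin
    parity (c (suc a))        ≡⟨ cong parity (c-suc a) ⟩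
    parity (step a (c a))     ≡⟨ parity-Adj (IsMatching.adjacent (if-matching f-match g-match (isEven a)) (c a)) ⟩
    not (parity (c a))        ≡⟨ cong not (parity-c a) ⟩
    not (not (isEven a))      ∎

  c-periodic : ∀ a → c (L + a) ≡ c a
  c-periodic a = trans (alt-double+ f g origin (suc Q) a) (cong (λ w → alt f g w a) c-L)

  c-injective : InjectiveBelow c L
  c-injective = proj₁ (proj₂ tour)

  c-origin : ∀ b → b < L → c b ≡ origin → b ≡ 0
  c-origin b b< e = c-injective b 0 b< (s≤s z≤n) e

  c-injective-<2L : ∀ A A' → A < L + L → A' < L + L → c A ≡ c A' →
                    A ≡ A' ⊎ (A ≡ L + A' ⊎ A' ≡ L + A)
  c-injective-<2L A A' A< A'< e with split-<2L L A A< | split-<2L L A' A'<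
  ... | inj₁ p | inj₁ p' = inj₁ (c-injective A A' p p' e)
  ... | inj₁ p | inj₂ (A₀' , p' , refl) =
    inj₂ (inj₂ (cong (L +_) (sym (c-injective A A₀' p p' (trans e (c-periodic A₀'))))))
  ... | inj₂ (A₀ , p , refl) | inj₁ p' =
    inj₂ (inj₁ (cong (L +_) (c-injective A₀ A' p p' (trans (sym (c-periodic A₀)) e))))
  ... | inj₂ (A₀ , p , refl) | inj₂ (A₀' , p' , refl) =
    inj₁ (cong (L +_) (c-injective A₀ A₀' p p' (trans (sym (c-periodic A₀)) (trans e (c-periodic A₀')))))

  c-injective-≤L : ∀ B B' → B ≤ L → B' ≤ L → c B ≡ c B' →
                   B ≡ B' ⊎ ((B ≡ 0 × B' ≡ L) ⊎ (B ≡ L × B' ≡ 0))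
  c-injective-≤L B B' B≤ B'≤ e with m≤n⇒m<n∨m≡n B≤ | m≤n⇒m<n∨m≡n B'≤
  ... | inj₁ p    | inj₁ p'   = inj₁ (c-injective B B' p p' e)
  ... | inj₁ p    | inj₂ refl = inj₂ (inj₁ (c-origin B p (trans e c-L) , refl))
  ... | inj₂ refl | inj₁ p'   = inj₂ (inj₂ (refl , c-origin B' p' (trans (sym e) c-L)))
  ... | inj₂ refl | inj₂ refl = inj₁ refl

-- For L = 2(Q+1) we have L² = 2(K+1) with K = sqK Q.
sqK : ℕ → ℕ
sqK Q = Q * double (suc Q) + suc (double Q)

square≡double : ∀ Q → double (suc Q) * double (suc Q) ≡ double (suc (sqK Q))
square≡double Q = begin
  L * L                    ≡⟨ cong (_* L) (double≡+ (suc Q)) ⟩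
  (suc Q + suc Q) * L      ≡⟨ *-distribʳ-+ L (suc Q) (suc Q) ⟩
  suc Q * L + suc Q * L    ≡⟨ sym (double≡+ (suc Q * L)) ⟩
  double (L + Q * L)       ≡⟨ cong double (cong suc (+-comm (suc (double Q)) (Q * L))) ⟩
  double (suc (sqK Q))     ∎
  where
  L : ℕ
  L = double (suc Q)

δ γ : ∀ {m} → Vertex m → Bool
δ y = parity y xor isOrigin y
γ x = not (parity x)

hmove : ∀ {m} → (h₀ h₁ : Vertex m → Vertex m) → Pair m → Pair m
hmove h₀ h₁ (x , y) = ((if δ y then h₁ else h₀) x , y)

vmove : ∀ {m} → (v₀ v₁ : Vertex m → Vertex m) → Pair m → Pair m
vmove v₀ v₁ (x , y) = (x , (if γ x then v₁ else v₀) y)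

hmove-involutive : ∀ {m} {h₀ h₁ : Vertex m → Vertex m} → IsMatching h₀ → IsMatching h₁ →
                   ∀ w → hmove h₀ h₁ (hmove h₀ h₁ w) ≡ w
hmove-involutive h₀-match h₁-match (x , y) =
  cong (_, y) (IsMatching.involutive (if-matching h₁-match h₀-match (δ y)) x)

vmove-involutive : ∀ {m} {v₀ v₁ : Vertex m → Vertex m} → IsMatching v₀ → IsMatching v₁ →
                   ∀ w → vmove v₀ v₁ (vmove v₀ v₁ w) ≡ w
vmove-involutive v₀-match v₁-match (x , y) =
  cong (x ,_) (IsMatching.involutive (if-matching v₁-match v₀-match (γ x)) y)

hmove-adjacent : ∀ {m} {h₀ h₁ : Vertex m → Vertex m} → IsMatching h₀ → IsMatching h₁ →
                 ∀ w → Adj (join w) (join (hmove h₀ h₁ w))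
hmove-adjacent h₀-match h₁-match (x , y) = Adj-++ˡ y (IsMatching.adjacent (if-matching h₁-match h₀-match (δ y)) x)

vmove-adjacent : ∀ {m} {v₀ v₁ : Vertex m → Vertex m} → IsMatching v₀ → IsMatching v₁ →
                 ∀ w → Adj (join w) (join (vmove v₀ v₁ w))
vmove-adjacent v₀-match v₁-match (x , y) = Adj-++ʳ x (IsMatching.adjacent (if-matching v₁-match v₀-match (γ x)) y)

-- We show that the walk from (origin , origin) alternating the two moves is
-- a tour of all L² pairs: after 1 + 2(jL + c) steps, respectively one step
-- more, it is at position σ c false, respectively position σ c true, where
-- σ = Q - j (see `position`).  The walk thus sweeps the torus row by row,
-- each row advancing the horizontal coordinate, and the map
-- (σ , c , r) ↦ position σ c r is injective and onto.
module Torus {m : ℕ} {h₀ h₁ v₀ v₁ : Vertex m → Vertex m}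
  (h₀-match : IsMatching h₀) (h₁-match : IsMatching h₁)
  (v₀-match : IsMatching v₀) (v₁-match : IsMatching v₁)
  (Q : ℕ)
  (htour : Tour (alt h₀ h₁ origin) (double (suc Q)))
  (vtour : Tour (alt v₀ v₁ origin) (double (suc Q)))
  where

  module CH = AltCycle h₀-match h₁-match Q htour
  module CV = AltCycle v₀-match v₁-match Q vtour

  D L : ℕ
  D = double Q
  L = suc (suc D)

  ch cv : ℕ → Vertex m
  ch = CH.c
  cv = CV.c

  horizontal vertical : Pair m → Pair m
  horizontal = hmove h₀ h₁
  vertical   = vmove v₀ v₁

  walk : ℕ → Pair m
  walk = alt horizontal vertical (origin , origin)

  -- Column c of the row with offset σ; r says whether the vertical move
  -- of that column has been made.
  position : ℕ → ℕ → Bool → Pair m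
  position σ c false = (ch (suc (c + double σ)) , cv c)
  position σ c true  = (ch (suc (c + double σ)) , cv (suc c))

  δ-origin : δ (origin {m}) ≡ true
  δ-origin = cong₂ _xor_ (parity-origin {m}) (isOrigin-origin {m})

  isEven-column : ∀ c σ → isEven (suc (c + double σ)) ≡ not (isEven c)
  isEven-column c σ = cong not (isEven-+double c σ)

  walk-odd : ∀ x → walk (suc (suc (double x))) ≡ vertical (walk (suc (double x)))
  walk-odd x = trans (alt-suc horizontal vertical _ (suc (double x)))
    (cong (λ b → (if not b then horizontal else vertical) (walk (suc (double x)))) (isEven-double x))

  walk-even : ∀ x → walk (suc (suc (suc (double x)))) ≡ horizontal (walk (suc (suc (double x))))
  walk-even x = trans (alt-suc horizontal vertical _ (suc (suc (double x))))
    (cong (λ b → (if not (not b) then horizontal else vertical) (walk (suc (suc (double x))))) (isEven-double x))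

  vertical-move : ∀ σ c → vertical (position σ c false) ≡ position σ c true
  vertical-move σ c = cong (ch A ,_) (begin
    (if γ (ch A) then v₁ else v₀) (cv c)       ≡⟨ cong (λ b → (if b then v₁ else v₀) (cv c)) γ≡ ⟩
    (if not (isEven c) then v₁ else v₀) (cv c) ≡⟨ cong-app (if-not (isEven c)) (cv c) ⟩
    CV.step c (cv c)                           ≡⟨ sym (CV.c-suc c) ⟩
    cv (suc c)                                 ∎)
    where
    A : ℕ
    A = suc (c + double σ)
    γ≡ : γ (ch A) ≡ not (isEven c)
    γ≡ = trans (cong not (CH.parity-c A)) (trans (not-involutive _) (isEven-column c σ))

  horizontal-move : ∀ σ c → suc c < L → horizontal (position σ c true) ≡ position σ (suc c) false
  horizontal-move σ c c< = cong (_, cv (suc c)) (begin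
    (if δ (cv (suc c)) then h₁ else h₀) (ch A) ≡⟨ cong (λ b → (if b then h₁ else h₀) (ch A)) δ≡ ⟩
    (if isEven c then h₁ else h₀) (ch A)       ≡⟨ cong-app (sym (if-not (isEven c))) (ch A) ⟩
    (if not (isEven c) then h₀ else h₁) (ch A) ≡⟨ cong (λ b → (if b then h₀ else h₁) (ch A)) (sym (isEven-column c σ)) ⟩
    CH.step A (ch A)                           ≡⟨ sym (CH.c-suc A) ⟩
    ch (suc A)                                 ∎)
    where
    A : ℕ
    A = suc (c + double σ)
    not-origin : isOrigin (cv (suc c)) ≡ false
    not-origin = isOrigin-≢ _ (λ e → 1+n≢0 (CV.c-origin (suc c) c< e))
    δ≡ : δ (cv (suc c)) ≡ isEven c
    δ≡ = trans (cong₂ _xor_ (trans (CV.parity-c (suc c)) (not-involutive _)) not-origin) (xor-identityʳ (isEven c))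

  -- At the end of a row the vertical coordinate is back at the origin and
  -- the horizontal one steps back, starting the next row two places earlier.
  wrap-move : ∀ σ → horizontal (position (suc σ) (suc D) true) ≡ position σ 0 false
  wrap-move σ = cong₂ _,_ first CV.c-L
    where
    A : ℕ
    A = suc D + suc (suc (double σ))
    A≡ : A ≡ L + suc (double σ)
    A≡ = cong suc (+-suc D (suc (double σ)))
    A-odd : isEven A ≡ false
    A-odd = trans (cong isEven A≡) (trans (isEven-double+ (suc Q) (suc (double σ))) (cong not (isEven-double σ)))
    first : (if δ (cv L) then h₁ else h₀) (ch (suc A)) ≡ ch (suc (double σ))
    first = begin
      (if δ (cv L) then h₁ else h₀) (ch (suc A)) ≡⟨ cong (λ y → (if δ y then h₁ else h₀) (ch (suc A))) CV.c-L ⟩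
      (if δ (origin {m}) then h₁ else h₀) (ch (suc A)) ≡⟨ cong (λ b → (if b then h₁ else h₀) (ch (suc A))) δ-origin ⟩
      h₁ (ch (suc A))                            ≡⟨ cong (λ b → (if b then h₀ else h₁) (ch (suc A))) (sym A-odd) ⟩
      CH.step A (ch (suc A))                     ≡⟨ CH.c-pred A ⟩
      ch A                                       ≡⟨ cong ch A≡ ⟩
      ch (L + suc (double σ))                    ≡⟨ CH.c-periodic (suc (double σ)) ⟩
      ch (suc (double σ))                        ∎

  first-move : horizontal (origin , origin) ≡ position Q 0 false
  first-move = cong (_, origin) (begin
    (if δ (origin {m}) then h₁ else h₀) origin ≡⟨ cong (λ b → (if b then h₁ else h₀) origin) δ-origin ⟩
    h₁ origin                            ≡⟨ cong h₁ (sym CH.c-L) ⟩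
    h₁ (ch L)                            ≡⟨ cong (λ b → (if b then h₀ else h₁) (ch L)) (sym (cong not (isEven-double Q))) ⟩
    CH.step (suc D) (ch L)               ≡⟨ CH.c-pred (suc D) ⟩
    ch (suc D)                           ∎)

  row-end : ∀ a → suc (a + suc D) ≡ L + a + 0
  row-end a = trans (cong suc (+-comm a (suc D))) (sym (+-identityʳ (L + a)))

  vertical-step : ∀ x σ c → walk (suc (double x)) ≡ position σ c false →
                  walk (suc (suc (double x))) ≡ position σ c true
  vertical-step x σ c e = trans (walk-odd x) (trans (cong vertical e) (vertical-move σ c))

  walk-position : ∀ j σ → σ + j ≡ Q → ∀ c → c < L → walk (suc (double (j * L + c))) ≡ position σ c false
  walk-position zero    σ σ+0≡Q zero c< =
    trans first-move (cong (λ s → position s 0 false) (sym (trans (sym (+-identityʳ σ)) σ+0≡Q)))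
  walk-position (suc j) σ σ+j≡Q zero c< =
    subst (λ n → walk (suc (double n)) ≡ position σ 0 false) (row-end (j * L))
      (trans (walk-even (j * L + suc D))
        (trans (cong horizontal (vertical-step (j * L + suc D) (suc σ) (suc D)
                  (walk-position j (suc σ) (trans (sym (+-suc σ j)) σ+j≡Q) (suc D) (n<1+n (suc D)))))
          (wrap-move σ)))
  walk-position j σ σ+j≡Q (suc c) c< =
    subst (λ n → walk (suc (double n)) ≡ position σ (suc c) false) (sym (+-suc (j * L) c))
      (trans (walk-even (j * L + c))
        (trans (cong horizontal (vertical-step (j * L + c) σ c
                  (walk-position j σ σ+j≡Q c (<-trans (n<1+n c) c<))))
          (horizontal-move σ c c<)))

  walk-position′ : ∀ j σ → σ + j ≡ Q → ∀ c → c < L → ∀ r → walk (suc (bin (j * L + c) r)) ≡ position σ c r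
  walk-position′ j σ e c c< false = walk-position j σ e c c<
  walk-position′ j σ e c c< true  = vertical-step (j * L + c) σ c (walk-position j σ e c c<)

  K N : ℕ
  K = sqK Q
  N = double (suc K)

  suc-K : suc K ≡ L + Q * L
  suc-K = trans (row-end (Q * L)) (+-identityʳ _)

  Decomposition : ℕ → Set
  Decomposition s = Σ ℕ λ σ → Σ ℕ λ c → Σ Bool λ r → Σ ℕ λ j →
                    σ + j ≡ Q × c < L × s ≡ bin (j * L + c) r

  row≤Q : ∀ j c → j * L + c < suc K → j ≤ Q
  row≤Q j c lt with j ≤? Q
  ... | yes j≤Q = j≤Q
  ... | no  j≰Q = ⊥-elim (<-irrefl refl (<-≤-trans lt
    (≤-trans (≤-reflexive suc-K) (≤-trans (*-monoˡ-≤ L (≰⇒> j≰Q)) (m≤m+n (j * L) c)))))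

  decompose : ∀ s → s < N → Decomposition s
  decompose s s< with divMod2 s
  ... | x , r , refl = Q ∸ j , c , r , j , m∸n+n≡m j≤Q , m%n<n x L , cong (λ k → bin k r) x≡
    where
    j c : ℕ
    j = x / L
    c = x % L
    x≡ : x ≡ j * L + c
    x≡ = trans (m≡m%n+[m/n]*n x L) (+-comm c (j * L))
    j≤Q : j ≤ Q
    j≤Q = row≤Q j c (subst (_< suc K) x≡ (bin-cancel-< x r (suc K) s<))

  walk-closed : walk N ≡ (origin , origin)
  walk-closed = trans (walk-position′ Q 0 refl (suc D) (n<1+n (suc D)) true)
                      (cong₂ _,_ (trans (cong (λ n → ch (suc n)) (+-identityʳ (suc D))) CH.c-L) CV.c-L)

  -- Injectivity of positions.  The horizontal times 1 + c + 2σ of two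
  -- positions in admissible range lie below 2L, so they agree up to a
  -- multiple of L, and a shift by L is too large.
  D<L : D < L
  D<L = <-trans (n<1+n D) (n<1+n (suc D))

  column<2L : ∀ σ c → σ ≤ Q → c < L → suc (c + double σ) < L + L
  column<2L σ c σ≤ c< = ≤-<-trans (+-mono-≤ c< (double-mono σ≤)) (+-monoʳ-< L D<L)

  no-wrap : ∀ σ c σ' c' → σ ≤ Q → c ≤ suc c' → suc (c + double σ) ≢ L + suc (c' + double σ')
  no-wrap σ c σ' c' σ≤ c≤ eq = <-irrefl eq (≤-<-trans (s≤s (+-mono-≤ c≤ (double-mono σ≤)))
    (<-≤-trans (s≤s (s≤s (≤-reflexive (+-comm (suc c') D)))) (+-monoʳ-≤ L (s≤s (m≤m+n c' (double σ'))))))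

  same-column : ∀ σ c σ' → σ ≤ Q → σ' ≤ Q → c < L →
                ch (suc (c + double σ)) ≡ ch (suc (c + double σ')) → σ ≡ σ'
  same-column σ c σ' σ≤ σ'≤ c< e with CH.c-injective-<2L _ _ (column<2L σ c σ≤ c<) (column<2L σ' c σ'≤ c<) e
  ... | inj₁ eA        = double-injective σ σ' (+-cancelˡ-≡ c _ _ (suc-injective eA))
  ... | inj₂ (inj₁ eA) = ⊥-elim (no-wrap σ c σ' c σ≤ (n≤1+n c) eA)
  ... | inj₂ (inj₂ eA) = ⊥-elim (no-wrap σ' c σ c σ'≤ (n≤1+n c) eA)

  -- Positions of the two kinds never meet: their horizontal times have
  -- different parities, unless the vertical coordinate wraps around.
  false≢true-position : ∀ σ c σ' c' → σ ≤ Q → σ' ≤ Q → c < L → c' < L →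
                        position σ c false ≢ position σ' c' true
  false≢true-position σ c σ' c' σ≤ σ'≤ c< c'< eq
    with CV.c-injective-≤L c (suc c') (<⇒≤ c<) c'< (cong proj₂ eq)
  ... | inj₂ (inj₂ (c≡L , _)) = <-irrefl c≡L c<
  ... | inj₁ refl with CH.c-injective-<2L _ _ (column<2L σ (suc c') σ≤ c<) (column<2L σ' c' σ'≤ c'<) (cong proj₁ eq)
  ...   | inj₁ eA        = odd≢even σ σ' (+-cancelˡ-≡ c' _ _ (trans (+-suc c' (double σ)) (suc-injective eA)))
  ...   | inj₂ (inj₁ eA) = no-wrap σ (suc c') σ' c' σ≤ ≤-refl eA
  ...   | inj₂ (inj₂ eA) = no-wrap σ' c' σ (suc c') σ'≤ (≤-trans (n≤1+n c') (n≤1+n (suc c'))) eA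
  false≢true-position σ c σ' c' σ≤ σ'≤ c< c'< eq | inj₂ (inj₁ (refl , 1+c'≡L)) with suc-injective 1+c'≡L
  ... | refl with CH.c-injective-<2L _ _ (column<2L σ 0 σ≤ c<) (column<2L σ' (suc D) σ'≤ c'<) (cong proj₁ eq)
  ...   | inj₁ eA        = odd≢even (Q + σ') σ (sym (trans (suc-injective eA) (cong suc (sym (double-+ Q σ')))))
  ...   | inj₂ (inj₁ eA) = no-wrap σ 0 σ' (suc D) σ≤ z≤n eA
  ...   | inj₂ (inj₂ eA) = odd≢even σ σ' (sym (+-cancelˡ-≡ D _ _ (suc-injective (suc-injective eA))))

  position-injective : ∀ σ c r σ' c' r' → σ ≤ Q → σ' ≤ Q → c < L → c' < L →
                       position σ c r ≡ position σ' c' r' → σ ≡ σ' × c ≡ c' × r ≡ r'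
  position-injective σ c false σ' c' true  σ≤ σ'≤ c< c'< eq = ⊥-elim (false≢true-position σ c σ' c' σ≤ σ'≤ c< c'< eq)
  position-injective σ c true  σ' c' false σ≤ σ'≤ c< c'< eq = ⊥-elim (false≢true-position σ' c' σ c σ'≤ σ≤ c'< c< (sym eq))
  position-injective σ c false σ' c' false σ≤ σ'≤ c< c'< eq
    with CV.c-injective-≤L c c' (<⇒≤ c<) (<⇒≤ c'<) (cong proj₂ eq)
  ... | inj₁ refl              = same-column σ c σ' σ≤ σ'≤ c< (cong proj₁ eq) , refl , refl
  ... | inj₂ (inj₁ (_ , c'≡L)) = ⊥-elim (<-irrefl c'≡L c'<)
  ... | inj₂ (inj₂ (c≡L , _))  = ⊥-elim (<-irrefl c≡L c<)
  position-injective σ c true  σ' c' true  σ≤ σ'≤ c< c'< eq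
    with CV.c-injective-≤L (suc c) (suc c') c< c'< (cong proj₂ eq)
  ... | inj₁ refl        = same-column σ c σ' σ≤ σ'≤ c< (cong proj₁ eq) , refl , refl
  ... | inj₂ (inj₁ (() , _))
  ... | inj₂ (inj₂ (_ , ()))

  σ≤Q : ∀ σ j → σ + j ≡ Q → σ ≤ Q
  σ≤Q σ j e = subst (σ ≤_) e (m≤m+n σ j)

  walk-injective : InjectiveBelow (λ s → walk (suc s)) N
  walk-injective s s' s< s'< eq with decompose s s< | decompose s' s'<
  ... | σ , c , r , j , e , c< , refl | σ' , c' , r' , j' , e' , c'< , refl
      with position-injective σ c r σ' c' r' (σ≤Q σ j e) (σ≤Q σ' j' e') c< c'<
             (trans (sym (walk-position′ j σ e c c< r)) (trans eq (walk-position′ j' σ' e' c' c'< r')))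
  ... | refl , refl , refl with +-cancelˡ-≡ σ j j' (trans e (sym e'))
  ... | refl = refl

  Hit : ℕ → ℕ → Set
  Hit a b = Σ ℕ λ σ → Σ ℕ λ c → Σ Bool λ r → σ ≤ Q × c < L × position σ c r ≡ (ch a , cv b)

  fold-offset : ∀ h → h < L → Σ ℕ λ σ → σ ≤ Q × (∀ t → ch (t + double h) ≡ ch (t + double σ))
  fold-offset h h< with h ≤? Q
  ... | yes h≤Q = h , h≤Q , λ t → refl
  ... | no  h≰Q = h ∸ suc Q , σ≤Q′ , shift
    where
    h≡ : suc Q + (h ∸ suc Q) ≡ h
    h≡ = m+[n∸m]≡n (≰⇒> h≰Q)
    σ≤Q′ : h ∸ suc Q ≤ Q
    σ≤Q′ = ≤-pred (+-cancelˡ-< (suc Q) _ _ (subst₂ _<_ (sym h≡) (double≡+ (suc Q)) h<))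
    shift : ∀ t → ch (t + double h) ≡ ch (t + double (h ∸ suc Q))
    shift t = begin
      ch (t + double h)                            ≡⟨ cong (λ k → ch (t + double k)) (sym h≡) ⟩
      ch (t + double (suc Q + (h ∸ suc Q)))        ≡⟨ cong (λ k → ch (t + k)) (double-+ (suc Q) (h ∸ suc Q)) ⟩
      ch (t + (L + double (h ∸ suc Q)))            ≡⟨ cong ch (+-comm t (L + _)) ⟩
      ch ((L + double (h ∸ suc Q)) + t)            ≡⟨ cong ch (+-assoc L _ t) ⟩
      ch (L + (double (h ∸ suc Q) + t))            ≡⟨ CH.c-periodic _ ⟩
      ch (double (h ∸ suc Q) + t)                  ≡⟨ cong ch (+-comm _ t) ⟩
      ch (t + double (h ∸ suc Q))                  ∎

  hit : ∀ a b → a < L → b < L → Hit a b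
  hit a zero a< _ with divMod2 a
  ... | h , true  , refl = h , 0 , false , double-cancel-≤ h Q (≤-pred (≤-pred a<)) , s≤s z≤n , refl
  ... | h , false , refl = h , suc D , true , ≤-pred (double-cancel-< h (suc Q) a<) , n<1+n (suc D) ,
                           cong₂ _,_ (CH.c-periodic (double h)) CV.c-L
  hit a (suc b') a< b< = from-bits (divMod2 E)
    where
    E : ℕ
    E = (a + L) ∸ suc b'
    ch-a : ch a ≡ ch (suc b' + E)
    ch-a = trans (sym (trans (cong ch (+-comm a L)) (CH.c-periodic a)))
                 (cong ch (sym (m+[n∸m]≡n (≤-trans (<⇒≤ b<) (m≤n+m L a)))))
    E<2L : E < double L
    E<2L = subst (E <_) (sym (double≡+ L)) (≤-<-trans (m∸n≤m (a + L) (suc b')) (+-monoˡ-< L a<))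
    from-bits : (Σ ℕ λ h → Σ Bool λ r → E ≡ bin h r) → Hit a (suc b')
    from-bits (h , true , E≡) with fold-offset h (bin-cancel-< h true L (subst (_< double L) E≡ E<2L))
    ... | σ , σ≤ , fold = σ , suc b' , false , σ≤ , b< , cong (_, cv (suc b')) (sym (begin
      ch a                          ≡⟨ ch-a ⟩
      ch (suc b' + E)               ≡⟨ cong (λ e → ch (suc b' + e)) E≡ ⟩
      ch (suc b' + suc (double h))  ≡⟨ cong ch (+-suc (suc b') (double h)) ⟩
      ch (suc (suc b') + double h)  ≡⟨ fold (suc (suc b')) ⟩
      ch (suc (suc b') + double σ)  ∎))
    from-bits (h , false , E≡) with fold-offset h (bin-cancel-< h false L (subst (_< double L) E≡ E<2L))
    ... | σ , σ≤ , fold = σ , b' , true , σ≤ , <-trans (n<1+n b') b< , cong (_, cv (suc b')) (sym (begin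
      ch a                          ≡⟨ ch-a ⟩
      ch (suc b' + E)               ≡⟨ cong (λ e → ch (suc b' + e)) E≡ ⟩
      ch (suc b' + double h)        ≡⟨ fold (suc b') ⟩
      ch (suc b' + double σ)        ∎))

  walk-surjective : SurjectiveBelow (λ s → walk (suc s)) N
  walk-surjective (x , y) with proj₂ (proj₂ htour) x | proj₂ (proj₂ vtour) y
  ... | a , a< , refl | b , b< , refl with hit a b a< b<
  ... | σ , c , r , σ≤ , c< , e = bin (j * L + c) r , bin-mono-< _ _ r row< ,
                                  trans (walk-position′ j σ σ+j≡Q c c< r) e
    where
    j : ℕ
    j = Q ∸ σ
    σ+j≡Q : σ + j ≡ Q
    σ+j≡Q = m+[n∸m]≡n σ≤
    row< : j * L + c < suc K
    row< = <-≤-trans (+-monoʳ-< (j * L) c<)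
             (≤-trans (+-monoˡ-≤ L (*-monoˡ-≤ L (m∸n≤m Q σ))) (≤-reflexive (trans (+-comm (Q * L) L) (sym suc-K))))

  torus-tour : Tour walk N
  torus-tour = tour-of-shift walk (suc (double K)) walk-closed walk-injective walk-surjective


record CyclicFamily (m : ℕ) : Set where
  field
    p        : ℕ → Vertex m → Vertex m
    periodic : ∀ k u → p (m + k) u ≡ p k u
    matching : ∀ k → IsMatching (p k)
    distinct : ∀ k j u → 0 < j → j < m → p k u ≢ p (k + j) u
    Q        : ℕ
    size     : 2 ^ m ≡ double (suc Q)
    tour     : ∀ k → Tour (alt (p k) (p (suc k)) origin) (double (suc Q))

base-family : CyclicFamily 1
base-family = record
  { p        = λ _ → flip
  ; periodic = λ _ _ → refl
  ; matching = λ _ → record { involutive = λ { (b ∷ []) → cong (_∷ []) (not-involutive b) }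
                             ; adjacent   = λ { (b ∷ []) → here b [] } }
  ; distinct = λ { _ zero _ () _ ; _ (suc j) _ _ (s≤s ()) }
  ; Q        = 0
  ; size     = refl
  ; tour     = λ _ → refl , injective , surjective
  }
  where
  flip : Vertex 1 → Vertex 1
  flip (b ∷ []) = not b ∷ []
  injective : InjectiveBelow (alt flip flip origin) 2
  injective zero          zero          _ _ _  = refl
  injective zero          (suc zero)    _ _ ()
  injective (suc zero)    zero          _ _ ()
  injective (suc zero)    (suc zero)    _ _ _  = refl
  injective (suc (suc t)) t'            (s≤s (s≤s ())) _ _
  injective t             (suc (suc t')) _ (s≤s (s≤s ())) _
  surjective : SurjectiveBelow (alt flip flip origin) 2
  surjective (false ∷ []) = 0 , s≤s z≤n , refl
  surjective (true ∷ [])  = 1 , s≤s (s≤s z≤n) , refl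

if-distinct : ∀ {m} {f g f' g' : Vertex m → Vertex m} (x : Vertex m) → f x ≢ f' x → g x ≢ g' x →
              ∀ b → (if b then f else g) x ≢ (if b then f' else g') x
if-distinct x f≢ g≢ true  = f≢
if-distinct x f≢ g≢ false = g≢

hmove-cong : ∀ {m} {h₀ h₁ h₀' h₁' : Vertex m → Vertex m} → (∀ x → h₀ x ≡ h₀' x) → (∀ x → h₁ x ≡ h₁' x) →
             ∀ w → hmove h₀ h₁ w ≡ hmove h₀' h₁' w
hmove-cong e₀ e₁ (x , y) with δ y
... | true  = cong (_, y) (e₁ x)
... | false = cong (_, y) (e₀ x)

vmove-cong : ∀ {m} {v₀ v₁ v₀' v₁' : Vertex m → Vertex m} → (∀ x → v₀ x ≡ v₀' x) → (∀ x → v₁ x ≡ v₁' x) →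
             ∀ w → vmove v₀ v₁ w ≡ vmove v₀' v₁' w
vmove-cong e₀ e₁ (x , y) with γ x
... | true  = cong (x ,_) (e₁ y)
... | false = cong (x ,_) (e₀ y)

-- Two consecutive matchings form a torus
-- walk (run backwards when the first one is vertical).
module Doubling {m : ℕ} (F : CyclicFamily m) where
  open CyclicFamily F

  H V : ℕ → Pair m → Pair m
  H h = hmove (p h) (p (suc h))
  V h = vmove (p h) (p (suc h))

  P : ℕ → Pair m → Pair m
  P n = if isEven n then H ⌊ n /2⌋ else V ⌊ n /2⌋

  P-double+ : ∀ a k w → P (double a + k) w ≡ (if isEven k then H (a + ⌊ k /2⌋) else V (a + ⌊ k /2⌋)) w
  P-double+ a k w = cong₂ (λ b h → (if b then H h else V h) w) (isEven-double+ a k) (⌊double+/2⌋ a k)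

  P-bin : ∀ h r w → P (bin h r) w ≡ (if r then V h else H h) w
  P-bin h r w = trans (cong₂ (λ b k → (if b then H k else V k) w) (isEven-bin h r) (⌊bin/2⌋ h r)) (lemma r)
    where
    lemma : ∀ r → (if not r then H h else V h) w ≡ (if r then V h else H h) w
    lemma true  = refl
    lemma false = refl

  P-involutive : ∀ n w → P n (P n w) ≡ w
  P-involutive n w with isEven n
  ... | true  = hmove-involutive (matching _) (matching _) w
  ... | false = vmove-involutive (matching _) (matching _) w

  P-adjacent : ∀ n w → Adj (join w) (join (P n w))
  P-adjacent n w with isEven n
  ... | true  = hmove-adjacent (matching _) (matching _) w
  ... | false = vmove-adjacent (matching _) (matching _) w

  p-periodic-suc : ∀ h x → p (suc (m + h)) x ≡ p (suc h) x
  p-periodic-suc h x = trans (cong (λ k → p k x) (sym (+-suc m h))) (periodic (suc h) x)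

  P-periodic : ∀ k w → P (double m + k) w ≡ P k w
  P-periodic k w with isEven k | P-double+ m k w
  ... | true  | e = trans e (hmove-cong (periodic _) (p-periodic-suc _) w)
  ... | false | e = trans e (vmove-cong (periodic _) (p-periodic-suc _) w)

  -- Matchings 2h and 2(h+a), 0 < a < m, move the same coordinate by
  -- matchings of the old family that disagree everywhere.
  same-kind-distinct : ∀ b h a w → 0 < a → a < m →
                       (if b then H h else V h) w ≢ (if b then H (a + h) else V (a + h)) w
  same-kind-distinct true  h a (x , y) a> a< e =
    if-distinct x (old-distinct (suc h) _ (cong suc (+-comm h a))) (old-distinct h _ (+-comm h a)) (δ y) (cong proj₁ e)
    where
    old-distinct : ∀ k k' → k + a ≡ k' → p k x ≢ p k' x
    old-distinct k k' k+a≡ e' = distinct k a x a> a< (trans e' (cong (λ i → p i x) (sym k+a≡)))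
  same-kind-distinct false h a (x , y) a> a< e =
    if-distinct y (old-distinct (suc h) _ (cong suc (+-comm h a))) (old-distinct h _ (+-comm h a)) (γ x) (cong proj₂ e)
    where
    old-distinct : ∀ k k' → k + a ≡ k' → p k y ≢ p k' y
    old-distinct k k' k+a≡ e' = distinct k a y a> a< (trans e' (cong (λ i → p i y) (sym k+a≡)))

  -- A horizontal move changes the first coordinate, a vertical one does not.
  other-kind-distinct : ∀ b h h' w → (if b then H h else V h) w ≢ (if not b then H h' else V h') w
  other-kind-distinct true  h h' (x , y) e =
    Adj-irreflexive (IsMatching.adjacent (if-matching (matching (suc h)) (matching h) (δ y)) x) (sym (cong proj₁ e))
  other-kind-distinct false h h' (x , y) e =
    Adj-irreflexive (IsMatching.adjacent (if-matching (matching (suc h')) (matching h') (δ y)) x) (cong proj₁ e)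

  P-distinct : ∀ k j w → 0 < j → j < m + m → P k w ≢ P (k + j) w
  P-distinct k j w j> j< e with divMod2 j
  ... | a , false , refl =
    same-kind-distinct (isEven k) ⌊ k /2⌋ a w (double-cancel-< 0 a j>)
      (double-cancel-< a m (subst (double a <_) (sym (double≡+ m)) j<))
      (trans e (trans (cong (λ n → P n w) (+-comm k (double a))) (P-double+ a k w)))
  ... | a , true , refl =
    other-kind-distinct (isEven k) ⌊ k /2⌋ h' w (trans e (cong (λ b → (if b then H h' else V h') w) odd-shift))
    where
    h' : ℕ
    h' = ⌊ k + suc (double a) /2⌋
    odd-shift : isEven (k + suc (double a)) ≡ not (isEven k)
    odd-shift = trans (cong isEven (+-suc k (double a))) (cong not (isEven-+double k a))

  module EvenTorus (h : ℕ) = Torus (matching h) (matching (suc h)) (matching h) (matching (suc h)) Q (tour h) (tour h)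
  module OddTorus (h : ℕ) =
    Torus (matching (suc h)) (matching (suc (suc h))) (matching h) (matching (suc h)) Q (tour (suc h)) (tour h)

  -- Matchings 2h, 2h+1 give the torus walk built from the cycle of p h,
  -- p (h+1) in both coordinates; matchings 2h+1, 2h+2 give, backwards, the
  -- torus walk built from the cycles of p (h+1), p (h+2) and of p h, p (h+1).
  P-tour : ∀ k → Tour (alt (P k) (P (suc k)) (origin , origin)) (double (suc (sqK Q)))
  P-tour k with divMod2 k
  ... | h , false , refl =
    tour-≗ (alt-cong (H h) (V h) (P (double h)) (P (suc (double h)))
             (λ w → sym (P-bin h false w)) (λ w → sym (P-bin h true w)) _)
           (EvenTorus.torus-tour h)
  ... | h , true , refl =
    tour-≗ (alt-cong (V h) (H (suc h)) (P (suc (double h))) (P (double (suc h)))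
             (λ w → sym (P-bin h true w)) (λ w → sym (P-bin (suc h) false w)) _)
           (Reverse.reversed (H (suc h)) (V h)
             (hmove-involutive (matching (suc h)) (matching (suc (suc h))))
             (vmove-involutive (matching h) (matching (suc h)))
             (origin , origin) (sqK Q) (OddTorus.torus-tour h))

  p′ : ℕ → Vertex (m + m) → Vertex (m + m)
  p′ n v = join (P n (split {m} v))

  p′-matching : ∀ k → IsMatching (p′ k)
  p′-matching k = record
    { involutive = λ v → begin
        join (P k (split (join (P k (split {m} v))))) ≡⟨ cong (join ∘ P k) (split-join (P k (split {m} v))) ⟩
        join (P k (P k (split {m} v)))               ≡⟨ cong join (P-involutive k (split {m} v)) ⟩
        join (split {m} v)                           ≡⟨ join-split {m} v ⟩
        v                                        ∎
    ; adjacent = λ v → subst (λ v' → Adj v' (p′ k v)) (join-split {m} v) (P-adjacent k (split {m} v))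
    }

  walk-join : ∀ k t → join (alt (P k) (P (suc k)) (origin , origin) t) ≡ alt (p′ k) (p′ (suc k)) origin t
  walk-join k t = trans
    (sym (alt-map join (P k) (P (suc k)) (p′ k) (p′ (suc k))
           (λ w → cong (join ∘ P k) (split-join w)) (λ w → cong (join ∘ P (suc k)) (split-join w)) _ t))
    (cong (λ u → alt (p′ k) (p′ (suc k)) u t) (origin-++ {m} {m}))

  doubled : CyclicFamily (m + m)
  doubled = record
    { p        = p′
    ; periodic = λ k v → cong join (trans (cong (λ n → P (n + k) (split {m} v)) (sym (double≡+ m))) (P-periodic k (split {m} v)))
    ; matching = p′-matching
    ; distinct = λ k j v j> j< e → P-distinct k j (split {m} v) j> j<
                   (trans (sym (split-join _)) (trans (cong (split {m}) e) (split-join _)))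
    ; Q        = sqK Q
    ; size     = trans (^-distribˡ-+-* 2 m m) (trans (cong₂ _*_ size size) (square≡double Q))
    ; tour     = λ k → tour-≗ (walk-join k) (tour-map join (split {m}) split-join (join-split {m}) (P-tour k))
    }

family : ∀ n → CyclicFamily (2 ^ n)
family zero    = base-family
family (suc n) = subst CyclicFamily (cong (2 ^ n +_) (sym (+-identityʳ (2 ^ n)))) (Doubling.doubled (family n))

next-closed : {A : Set} {N : ℕ} (i : Fin N) (w : ℕ → A) → w N ≡ w 0 → w (toℕ (next i)) ≡ w (suc (toℕ i))
next-closed {N = suc N} i w closed with m≤n⇒m<n∨m≡n (toℕ<n i)
... | inj₁ i+1<N  = cong w (trans (toℕ-fromℕ< _) (m<n⇒m%n≡m i+1<N))
... | inj₂ i+1≡N = trans (cong w (trans (toℕ-fromℕ< _) (trans (cong (_% suc N) i+1≡N) (n%n≡0 (suc N)))))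
                         (trans (sym closed) (cong w (sym i+1≡N)))

hamiltonian-⇔ : ∀ {d} {E E' : EdgeSet d} → (∀ u v → E u v → E' u v) → (∀ u v → E' u v → E u v) →
                IsHamiltonianCycleEdgeSet d E → IsHamiltonianCycleEdgeSet d E'
hamiltonian-⇔ E⇒E' E'⇒E (c , hamiltonian , edges) =
  c , hamiltonian , λ u v → (proj₁ (edges u v) ∘ E'⇒E u v) , (E⇒E' u v ∘ proj₂ (edges u v))

module HamiltonianUnion {d : ℕ} {f g : Vertex d → Vertex d} (f-match : IsMatching f) (g-match : IsMatching g)
  (Q : ℕ) (size : 2 ^ d ≡ double (suc Q)) (tour : Tour (alt f g origin) (double (suc Q))) where

  module C = AltCycle f-match g-match Q tour
  open C using (L; step)

  w : ℕ → Vertex d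
  w = alt f g origin

  c : Fin (2 ^ d) → Vertex d
  c i = w (toℕ i)

  toℕ<L : ∀ (i : Fin (2 ^ d)) → toℕ i < L
  toℕ<L i = subst (toℕ i <_) size (toℕ<n i)

  <L⇒<2^d : ∀ a → a < L → a < 2 ^ d
  <L⇒<2^d a a< = subst (a <_) (sym size) a<

  fin : ∀ a → a < L → Fin (2 ^ d)
  fin a a< = fromℕ< (<L⇒<2^d a a<)

  c-fin : ∀ a a< → c (fin a a<) ≡ w a
  c-fin a a< = cong w (toℕ-fromℕ< (<L⇒<2^d a a<))

  c-next : ∀ i → c (next i) ≡ step (toℕ i) (c i)
  c-next i = trans (next-closed i w (trans (cong w size) C.c-L)) (C.c-suc (toℕ i))

  c-next-fin : ∀ a a< → c (next (fin a a<)) ≡ w (suc a)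
  c-next-fin a a< = trans (c-next (fin a a<)) (trans (cong (λ t → step t (w t)) (toℕ-fromℕ< (<L⇒<2^d a a<))) (sym (C.c-suc a)))

  predecessor : ∀ a → a < L → Σ ℕ λ a' → a' < L × w (suc a') ≡ w a × isEven a' ≡ not (isEven a)
  predecessor zero    _  = suc (double Q) , ≤-refl , C.c-L , cong not (isEven-double Q)
  predecessor (suc a) a< = a , <-trans (n<1+n a) a< , refl , sym (not-involutive (isEven a))

  edge : ∀ u b → CycleEdges d c u ((if b then f else g) u)
  edge u b with proj₂ (proj₂ tour) u
  ... | a , a< , refl with isEven a Data.Bool.≟ b
  ... | yes refl = fin a a< , inj₁ (c-fin a a< , trans (c-next-fin a a<) (C.c-suc a))
  ... | no  a≢b with predecessor a a<
  ...   | a' , a'< , w1+a'≡ , a'-parity = fin a' a'< , inj₂ (back , trans (c-next-fin a' a'<) w1+a'≡)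
    where
    a'-parity-b : isEven a' ≡ b
    a'-parity-b = trans a'-parity (trans (cong not (¬-not a≢b)) (not-involutive b))
    back : c (fin a' a'<) ≡ (if b then f else g) (w a)
    back = trans (c-fin a' a'<) (trans (sym (C.c-pred a'))
                 (cong₂ (λ b' x → (if b' then f else g) x) a'-parity-b w1+a'≡))

  from-step : ∀ u v b → (if b then f else g) u ≡ v → f u ≡ v ⊎ g u ≡ v
  from-step u v true  e = inj₁ e
  from-step u v false e = inj₂ e

  union-hamiltonian : IsHamiltonianCycleEdgeSet d (λ u v → f u ≡ v ⊎ g u ≡ v)
  union-hamiltonian = c , ((injective , surjective) , adjacent) , λ u v → to-cycle u v , from-cycle u v
    where
    injective : ∀ {i j} → c i ≡ c j → i ≡ j
    injective {i} {j} e = toℕ-injective (C.c-injective (toℕ i) (toℕ j) (toℕ<L i) (toℕ<L j) e)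
    surjective : ∀ y → ∃ λ i → ∀ {j} → j ≡ i → c j ≡ y
    surjective y with proj₂ (proj₂ tour) y
    ... | a , a< , e = fin a a< , λ { refl → trans (c-fin a a<) e }
    adjacent : ∀ i → Adjacent d (c i) (c (next i))
    adjacent i = Adj⇒Adjacent (subst (Adj (c i)) (sym (c-next i))
                   (IsMatching.adjacent (if-matching f-match g-match (isEven (toℕ i))) (c i)))
    to-cycle : ∀ u v → f u ≡ v ⊎ g u ≡ v → CycleEdges d c u v
    to-cycle u v (inj₁ refl) = edge u true
    to-cycle u v (inj₂ refl) = edge u false
    from-cycle : ∀ u v → CycleEdges d c u v → f u ≡ v ⊎ g u ≡ v
    from-cycle u v (i , inj₁ (refl , refl)) = from-step _ _ (isEven (toℕ i)) (sym (c-next i))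
    from-cycle u v (i , inj₂ (refl , refl)) = from-step _ _ (isEven (toℕ i))
      (trans (cong (step (toℕ i)) (c-next i))
             (IsMatching.involutive (if-matching f-match g-match (isEven (toℕ i))) (c i)))

matching-perfect : ∀ {m} {f : Vertex m → Vertex m} → IsMatching f → IsPerfectMatching m (λ u v → f u ≡ v)
matching-perfect {f = f} f-match =
  ((λ u v fu≡v → Adj⇒Adjacent (subst (Adj u) fu≡v (IsMatching.adjacent f-match u))) ,
   (λ u v fu≡v → trans (cong f (sym fu≡v)) (IsMatching.involutive f-match u))) ,
  (λ u → f u , refl , λ w fu≡w → sym fu≡w)

module FamilyMatchings {m : ℕ} (F : CyclicFamily m) where
  open CyclicFamily F

  M : Fin m → EdgeSet m
  M i u v = p (toℕ i) u ≡ v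

  ordered-disjoint : ∀ i j u → i < j → j < m → p i u ≢ p j u
  ordered-disjoint i j u i<j j<m e = distinct i (j ∸ i) u (m<n⇒0<n∸m i<j) (≤-<-trans (m∸n≤m j i) j<m)
    (trans e (cong (λ k → p k u) (sym (m+[n∸m]≡n (<⇒≤ i<j)))))

  disjoint : ∀ i j → i ≢ j → ∀ u v → ¬ (M i u v × M j u v)
  disjoint i j i≢j u v (e₁ , e₂) with <-cmp (toℕ i) (toℕ j)
  ... | tri< i<j _ _ = ordered-disjoint (toℕ i) (toℕ j) u i<j (toℕ<n j) (trans e₁ (sym e₂))
  ... | tri≈ _ i≡j _ = i≢j (toℕ-injective i≡j)
  ... | tri> _ _ j<i = ordered-disjoint (toℕ j) (toℕ i) u j<i (toℕ<n i) (trans e₂ (sym e₁))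

  p-next : ∀ i u → p (toℕ (next i)) u ≡ p (suc (toℕ i)) u
  p-next i u = next-closed i (λ k → p k u) (trans (cong (λ k → p k u) (sym (+-identityʳ m))) (periodic 0 u))

  hamiltonian : ∀ i → IsHamiltonianCycleEdgeSet m (M i ∪ M (next i))
  hamiltonian i = hamiltonian-⇔ (λ { u v (inj₁ e) → inj₁ e ; u v (inj₂ e) → inj₂ (trans (p-next i u) e) })
                                (λ { u v (inj₁ e) → inj₁ e ; u v (inj₂ e) → inj₂ (trans (sym (p-next i u)) e) })
                                (HamiltonianUnion.union-hamiltonian (matching k) (matching (suc k)) Q size (tour k))
    where
    k : ℕ
    k = toℕ i

theorem3p2 : (n : ℕ) → 1 ≤ n →
    Σ (Fin (2 ^ n) → EdgeSet (2 ^ n)) λ M →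
    (∀ i → IsPerfectMatching (2 ^ n) (M i)) ×
    (∀ i j → i ≢ j → ∀ u v → ¬ (M i u v × M j u v)) ×
    (∀ i → IsHamiltonianCycleEdgeSet (2 ^ n) (M i ∪ M (next i)))
theorem3p2 n _ = M , (λ i → matching-perfect (matching (toℕ i))) , disjoint , hamiltonian
  where
  open CyclicFamily (family n)
  open FamilyMatchings (family n)
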